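{- Let $\mathcal{G}_n$ be the set of words over $\{0,1\}$ with $n$ zeros and $n$ ones. There is an explicit bijection $\phi:\mathcal{G}_n\to\mathcal{G}_n$ such that for every $w\in\mathcal{G}_n$, $$o_{00}(w)=\#_{001}(\phi(w))\quad\text{and}\quad o_0(w)=\#_{01}(\phi(w)).$$
   Context: For $w=w_1\cdots w_{2n}\in\mathcal{G}_n$: $o_{00}(w)=|\{i\in\{1,\dots,n\}: w_{2i-1}w_{2i}=00\}|$; $o_0(w)=|\{i\in\{1,\dots,n\}: w_{2i-1}=0\}|$ (number of zeros in odd positions); $\#_{001}(w)$ and $\#_{01}(w)$ are the numbers of occurrences of $001$ and $01$, respectively, as consecutive subwords of $w$. -}

module Defs where

open import Data.Bool using (Bool; true; false)
open import Data.Nat using (ℕ; zero; suc; _+_; _*_)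
open import Data.List using (List; []; _∷_; length)
open import Data.Product using (Σ; _×_)
open import Relation.Binary.PropositionalEquality using (_≡_)

-- Letters: false = 0, true = 1.  Words over {0,1} are List Bool.

zeros : List Bool → ℕ
zeros [] = 0
zeros (false ∷ w) = suc (zeros w)
zeros (true ∷ w) = zeros w

ones : List Bool → ℕ
ones [] = 0
ones (false ∷ w) = ones w
ones (true ∷ w) = suc (ones w)

IsG : ℕ → List Bool → Set
IsG n w = (zeros w ≡ n) × (ones w ≡ n)

G : ℕ → Set
G n = Σ (List Bool) (IsG n)

o00 : List Bool → ℕ
o00 (false ∷ false ∷ w) = suc (o00 w)
o00 (_ ∷ _ ∷ w) = o00 w
o00 _ = 0

-- o₀(w): number of zeros in odd positions (1-indexed)
o0 : List Bool → ℕ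
o0 (false ∷ _ ∷ w) = suc (o0 w)
o0 (true ∷ _ ∷ w) = o0 w
o0 (false ∷ []) = 1
o0 _ = 0

count01 : List Bool → ℕ
count01 (false ∷ true ∷ w) = suc (count01 (true ∷ w))
count01 (_ ∷ w) = count01 w
count01 [] = 0

count001 : List Bool → ℕ
count001 (false ∷ false ∷ true ∷ w) = suc (count001 (false ∷ true ∷ w))
count001 (_ ∷ w) = count001 w
count001 [] = 0

{-# OPTIONS --safe #-}
-- Mark every zero of a word by whether a 1 follows it and every one by whether a 0 precedes it.
-- The two mark words determine the word, both contain #₀₁ ones, and a factor 001 of the word is
-- exactly a factor 01 of the zero marks.  Splitting w ∈ 𝒢ₙ into its n pairs gives a triple
-- (t, d, e): t marks the pairs opened by 0, d lists the closing letters of the pairs opened by 1,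
-- and e marks the pairs 00 among those opened by 0.  Counting letters gives |t| = n and |d|₁ = |e|₁.
-- For u ∈ 𝒢ₙ the triple (oneMarks u, zeroMarks s, oneMarks s) with s = zeroMarks u satisfies the
-- same constraints and determines u.  Composing the two correspondences, o₀ = |t|₁ becomes #₀₁ and
-- o₀₀ = |e|₁ = |d|₁ becomes #₀₀₁.

module Submission where

open import Defs
open import Data.Nat using (ℕ)
open import Data.Product using (Σ; _×_; proj₁)
open import Function.Bundles using (Bijection; _⤖_)
open import Relation.Binary.PropositionalEquality using (_≡_)

open import Data.Bool using (Bool; true; false; not)
open import Data.Bool.Properties using (not-involutive)
open import Data.Empty using (⊥-elim)
open import Data.List using (List; []; _∷_; length; replicate)
open import Data.Nat using (zero; suc; _+_; _<_; z<s)
open import Data.Nat.Properties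
  using (suc-injective; +-suc; +-cancelʳ-≡; ≡-irrelevant; m<n+m; <-asym)
open import Data.Product using (_,_; proj₂)
open import Data.Product.Properties using (Σ-≡,≡→≡)
open import Function.Bundles using (_↔_; mk↔ₛ′)
open import Function.Properties.Inverse using (↔-sym; ↔-trans; ↔⇒⤖)
open import Relation.Binary.PropositionalEquality
  using (refl; sym; trans; cong; cong₂; subst; module ≡-Reasoning)
open import Relation.Nullary using (Irrelevant)

length≡zeros+ones : ∀ w → length w ≡ zeros w + ones w
length≡zeros+ones []          = refl
length≡zeros+ones (false ∷ w) = cong suc (length≡zeros+ones w)
length≡zeros+ones (true ∷ w)  = trans (cong suc (length≡zeros+ones w)) (sym (+-suc _ _))

-- The i-th letter of zeroMarks u tells whether the i-th zero of u is followed by 1;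
-- the j-th letter of oneMarks u whether the j-th one of u is preceded by 0.
zeroMarks : List Bool → List Bool
zeroMarks []                  = []
zeroMarks (true ∷ u)          = zeroMarks u
zeroMarks (false ∷ [])        = false ∷ []
zeroMarks (false ∷ false ∷ u) = false ∷ zeroMarks (false ∷ u)
zeroMarks (false ∷ true ∷ u)  = true ∷ zeroMarks u

oneMarks : List Bool → List Bool
oneMarks []                  = []
oneMarks (true ∷ u)          = false ∷ oneMarks u
oneMarks (false ∷ [])        = []
oneMarks (false ∷ false ∷ u) = oneMarks (false ∷ u)
oneMarks (false ∷ true ∷ u)  = true ∷ oneMarks u

length-zeroMarks : ∀ u → length (zeroMarks u) ≡ zeros u
length-zeroMarks []                  = refl
length-zeroMarks (true ∷ u)          = length-zeroMarks u
length-zeroMarks (false ∷ [])        = refl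
length-zeroMarks (false ∷ false ∷ u) = cong suc (length-zeroMarks (false ∷ u))
length-zeroMarks (false ∷ true ∷ u)  = cong suc (length-zeroMarks u)

length-oneMarks : ∀ u → length (oneMarks u) ≡ ones u
length-oneMarks []                  = refl
length-oneMarks (true ∷ u)          = cong suc (length-oneMarks u)
length-oneMarks (false ∷ [])        = refl
length-oneMarks (false ∷ false ∷ u) = length-oneMarks (false ∷ u)
length-oneMarks (false ∷ true ∷ u)  = cong suc (length-oneMarks u)

ones-zeroMarks : ∀ u → ones (zeroMarks u) ≡ count01 u
ones-zeroMarks []                  = refl
ones-zeroMarks (true ∷ u)          = ones-zeroMarks u
ones-zeroMarks (false ∷ [])        = refl
ones-zeroMarks (false ∷ false ∷ u) = ones-zeroMarks (false ∷ u)
ones-zeroMarks (false ∷ true ∷ u)  = cong suc (ones-zeroMarks u)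

ones-oneMarks : ∀ u → ones (oneMarks u) ≡ count01 u
ones-oneMarks []                  = refl
ones-oneMarks (true ∷ u)          = ones-oneMarks u
ones-oneMarks (false ∷ [])        = refl
ones-oneMarks (false ∷ false ∷ u) = ones-oneMarks (false ∷ u)
ones-oneMarks (false ∷ true ∷ u)  = cong suc (ones-oneMarks u)

count001≡count01-zeroMarks : ∀ u → count001 u ≡ count01 (zeroMarks u)
count001≡count01-zeroMarks []                          = refl
count001≡count01-zeroMarks (true ∷ u)                  = count001≡count01-zeroMarks u
count001≡count01-zeroMarks (false ∷ [])                = refl
count001≡count01-zeroMarks (false ∷ true ∷ u)          = count001≡count01-zeroMarks u
count001≡count01-zeroMarks (false ∷ false ∷ [])        = refl
count001≡count01-zeroMarks (false ∷ false ∷ true ∷ u)  = cong suc (count001≡count01-zeroMarks u)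
count001≡count01-zeroMarks (false ∷ false ∷ false ∷ u) = count001≡count01-zeroMarks (false ∷ false ∷ u)

-- The clause for decode [] (true ∷ t) is junk: it is never used when ones s ≡ ones t.
decode : List Bool → List Bool → List Bool
decode s          []          = replicate (length s) false
decode s          (false ∷ t) = true ∷ decode s t
decode []         (true ∷ t)  = []
decode (false ∷ s) (true ∷ t) = false ∷ decode s (true ∷ t)
decode (true ∷ s) (true ∷ t)  = false ∷ true ∷ decode s t

decode-zeroMarks-oneMarks : ∀ u → decode (zeroMarks u) (oneMarks u) ≡ u
decode-zeroMarks-oneMarks []                  = refl
decode-zeroMarks-oneMarks (true ∷ u)          = cong (true ∷_) (decode-zeroMarks-oneMarks u)
decode-zeroMarks-oneMarks (false ∷ [])        = refl
decode-zeroMarks-oneMarks (false ∷ true ∷ u)  = cong (λ v → false ∷ true ∷ v) (decode-zeroMarks-oneMarks u)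
decode-zeroMarks-oneMarks (false ∷ false ∷ u) =
  trans (decode-leadingZero u) (cong (false ∷_) (decode-zeroMarks-oneMarks (false ∷ u)))
  where
  decode-leadingZero : ∀ u {s} → decode (false ∷ s) (oneMarks (false ∷ u)) ≡ false ∷ decode s (oneMarks (false ∷ u))
  decode-leadingZero []          = refl
  decode-leadingZero (true ∷ u)  = refl
  decode-leadingZero (false ∷ u) = decode-leadingZero u

zeroMarks-replicate : ∀ k → zeroMarks (replicate k false) ≡ replicate k false
zeroMarks-replicate zero          = refl
zeroMarks-replicate (suc zero)    = refl
zeroMarks-replicate (suc (suc k)) = cong (false ∷_) (zeroMarks-replicate (suc k))

oneMarks-replicate : ∀ k → oneMarks (replicate k false) ≡ []
oneMarks-replicate zero          = refl
oneMarks-replicate (suc zero)    = refl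
oneMarks-replicate (suc (suc k)) = oneMarks-replicate (suc k)

replicate-length : ∀ s → ones s ≡ 0 → replicate (length s) false ≡ s
replicate-length []          _ = refl
replicate-length (false ∷ s) h = cong (false ∷_) (replicate-length s h)

zeroMarks-decode : ∀ s t → ones s ≡ ones t → zeroMarks (decode s t) ≡ s
zeroMarks-decode s []                           h = trans (zeroMarks-replicate (length s)) (replicate-length s h)
zeroMarks-decode s (false ∷ t)                  h = zeroMarks-decode s t h
zeroMarks-decode (false ∷ false ∷ s) (true ∷ t) h = cong (false ∷_) (zeroMarks-decode (false ∷ s) (true ∷ t) h)
zeroMarks-decode (false ∷ true ∷ s) (true ∷ t)  h = cong (false ∷_) (zeroMarks-decode (true ∷ s) (true ∷ t) h)
zeroMarks-decode (true ∷ s) (true ∷ t)          h = cong (true ∷_) (zeroMarks-decode s t (suc-injective h))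

oneMarks-decode : ∀ s t → ones s ≡ ones t → oneMarks (decode s t) ≡ t
oneMarks-decode s []                           _ = oneMarks-replicate (length s)
oneMarks-decode s (false ∷ t)                  h = cong (false ∷_) (oneMarks-decode s t h)
oneMarks-decode (false ∷ false ∷ s) (true ∷ t) h = oneMarks-decode (false ∷ s) (true ∷ t) h
oneMarks-decode (false ∷ true ∷ s) (true ∷ t)  h = oneMarks-decode (true ∷ s) (true ∷ t) h
oneMarks-decode (true ∷ s) (true ∷ t)          h = cong (true ∷_) (oneMarks-decode s t (suc-injective h))

module _ (s t : List Bool) (s≈t : ones s ≡ ones t) where

  zeros-decode : zeros (decode s t) ≡ length s
  zeros-decode = trans (sym (length-zeroMarks (decode s t))) (cong length (zeroMarks-decode s t s≈t))

  ones-decode : ones (decode s t) ≡ length t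
  ones-decode = trans (sym (length-oneMarks (decode s t))) (cong length (oneMarks-decode s t s≈t))

  count01-decode : count01 (decode s t) ≡ ones s
  count01-decode = trans (sym (ones-zeroMarks (decode s t))) (cong ones (zeroMarks-decode s t s≈t))

  count001-decode : count001 (decode s t) ≡ count01 s
  count001-decode = trans (count001≡count01-zeroMarks (decode s t)) (cong count01 (zeroMarks-decode s t s≈t))

data EvenLength : List Bool → Set where
  []   : EvenLength []
  pair : ∀ {x y w} → EvenLength w → EvenLength (x ∷ y ∷ w)

evenLength : ∀ w n → length w ≡ n + n → EvenLength w
evenLength []          _       _ = []
evenLength (_ ∷ [])    (suc n) h with () ← trans (suc-injective h) (+-suc n n)
evenLength (_ ∷ _ ∷ w) (suc n) h = pair (evenLength w n (suc-injective (trans (suc-injective h) (+-suc n n))))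

Triple : Set
Triple = List Bool × List Bool × List Bool

zeroLed : List Bool → List Bool
zeroLed []              = []
zeroLed (_ ∷ [])        = []
zeroLed (false ∷ _ ∷ w) = true ∷ zeroLed w
zeroLed (true ∷ _ ∷ w)  = false ∷ zeroLed w

oneLedClosers : List Bool → List Bool
oneLedClosers []              = []
oneLedClosers (_ ∷ [])        = []
oneLedClosers (false ∷ _ ∷ w) = oneLedClosers w
oneLedClosers (true ∷ y ∷ w)  = y ∷ oneLedClosers w

zeroLedIs00 : List Bool → List Bool
zeroLedIs00 []              = []
zeroLedIs00 (_ ∷ [])        = []
zeroLedIs00 (false ∷ y ∷ w) = not y ∷ zeroLedIs00 w
zeroLedIs00 (true ∷ _ ∷ w)  = zeroLedIs00 w

splitPairs : List Bool → Triple
splitPairs w = zeroLed w , oneLedClosers w , zeroLedIs00 w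

assemblePairs : Triple → List Bool
assemblePairs (true ∷ t , d , x ∷ e)  = false ∷ not x ∷ assemblePairs (t , d , e)
assemblePairs (false ∷ t , y ∷ d , e) = true ∷ y ∷ assemblePairs (t , d , e)
assemblePairs _                       = []

length-oneLedClosers : ∀ w → length (oneLedClosers w) ≡ zeros (zeroLed w)
length-oneLedClosers []              = refl
length-oneLedClosers (_ ∷ [])        = refl
length-oneLedClosers (false ∷ _ ∷ w) = length-oneLedClosers w
length-oneLedClosers (true ∷ _ ∷ w)  = cong suc (length-oneLedClosers w)

length-zeroLedIs00 : ∀ w → length (zeroLedIs00 w) ≡ ones (zeroLed w)
length-zeroLedIs00 []              = refl
length-zeroLedIs00 (_ ∷ [])        = refl
length-zeroLedIs00 (false ∷ _ ∷ w) = cong suc (length-zeroLedIs00 w)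
length-zeroLedIs00 (true ∷ _ ∷ w)  = length-zeroLedIs00 w

o0≡ones-zeroLed : ∀ {w} → EvenLength w → o0 w ≡ ones (zeroLed w)
o0≡ones-zeroLed []                      = refl
o0≡ones-zeroLed (pair {false} {_} even) = cong suc (o0≡ones-zeroLed even)
o0≡ones-zeroLed (pair {true} {_} even)  = o0≡ones-zeroLed even

o00≡ones-zeroLedIs00 : ∀ w → o00 w ≡ ones (zeroLedIs00 w)
o00≡ones-zeroLedIs00 []                  = refl
o00≡ones-zeroLedIs00 (false ∷ [])        = refl
o00≡ones-zeroLedIs00 (true ∷ [])         = refl
o00≡ones-zeroLedIs00 (false ∷ false ∷ w) = cong suc (o00≡ones-zeroLedIs00 w)
o00≡ones-zeroLedIs00 (false ∷ true ∷ w)  = o00≡ones-zeroLedIs00 w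
o00≡ones-zeroLedIs00 (true ∷ _ ∷ w)      = o00≡ones-zeroLedIs00 w

-- A pair 00 contributes two zeros, 11 none, and 01, 10 one each.
zeros-splitPairs : ∀ {w} → EvenLength w →
                   zeros w + ones (oneLedClosers w) ≡ length (zeroLed w) + ones (zeroLedIs00 w)
zeros-splitPairs [] = refl
zeros-splitPairs (pair {false} {false} even) =
  cong suc (trans (cong suc (zeros-splitPairs even)) (sym (+-suc _ _)))
zeros-splitPairs (pair {false} {true} even)  = cong suc (zeros-splitPairs even)
zeros-splitPairs (pair {true} {false} even)  = cong suc (zeros-splitPairs even)
zeros-splitPairs (pair {true} {true} even)   = trans (+-suc _ _) (cong suc (zeros-splitPairs even))

ones-splitPairs : ∀ {w} → EvenLength w →
                  ones w + ones (zeroLedIs00 w) ≡ length (zeroLed w) + ones (oneLedClosers w)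
ones-splitPairs [] = refl
ones-splitPairs (pair {false} {false} even) = trans (+-suc _ _) (cong suc (ones-splitPairs even))
ones-splitPairs (pair {false} {true} even)  = cong suc (ones-splitPairs even)
ones-splitPairs (pair {true} {false} even)  = cong suc (ones-splitPairs even)
ones-splitPairs (pair {true} {true} even)   =
  cong suc (trans (cong suc (ones-splitPairs even)) (sym (+-suc _ _)))

assemblePairs-splitPairs : ∀ {w} → EvenLength w → assemblePairs (splitPairs w) ≡ w
assemblePairs-splitPairs [] = refl
assemblePairs-splitPairs (pair {false} {y} even) =
  cong₂ (λ x v → false ∷ x ∷ v) (not-involutive y) (assemblePairs-splitPairs even)
assemblePairs-splitPairs (pair {true} {y} even)  = cong (λ v → true ∷ y ∷ v) (assemblePairs-splitPairs even)

splitPairs-assemblePairs : ∀ {t d e} → length d ≡ zeros t → length e ≡ ones t →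
                           splitPairs (assemblePairs (t , d , e)) ≡ (t , d , e)
splitPairs-assemblePairs {[]} {[]} {[]} _ _ = refl
splitPairs-assemblePairs {true ∷ t} {_} {x ∷ e} hd he =
  cong₂ (λ { b (t′ , d′ , e′) → true ∷ t′ , d′ , b ∷ e′ })
        (not-involutive x) (splitPairs-assemblePairs hd (suc-injective he))
splitPairs-assemblePairs {false ∷ t} {y ∷ d} hd he =
  cong (λ { (t′ , d′ , e′) → false ∷ t′ , y ∷ d′ , e′ }) (splitPairs-assemblePairs (suc-injective hd) he)

evenLength-assemblePairs : ∀ τ → EvenLength (assemblePairs τ)
evenLength-assemblePairs (true ∷ t , d , _ ∷ e)  = pair (evenLength-assemblePairs (t , d , e))
evenLength-assemblePairs (false ∷ t , _ ∷ d , e) = pair (evenLength-assemblePairs (t , d , e))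
evenLength-assemblePairs ([] , _ , _)            = []
evenLength-assemblePairs (true ∷ _ , _ , [])     = []
evenLength-assemblePairs (false ∷ _ , [] , _)    = []

cross-cancel : ∀ n l d e → n + d ≡ l + e → n + e ≡ l + d → n ≡ l × d ≡ e
cross-cancel zero    zero    d e p _ = refl , p
cross-cancel (suc n) (suc l) d e p q with cross-cancel n l d e (suc-injective p) (suc-injective q)
... | n≡l , d≡e = cong suc n≡l , d≡e
cross-cancel zero    (suc l) d e p q =
  ⊥-elim (<-asym (subst (e <_) (sym p) (m<n+m e z<s)) (subst (d <_) (sym q) (m<n+m d z<s)))
cross-cancel (suc n) zero    d e p q =
  ⊥-elim (<-asym (subst (d <_) p (m<n+m d z<s)) (subst (e <_) q (m<n+m e z<s)))

+-cancelʳ-≡′ : ∀ {a b x y} → a + x ≡ b + y → x ≡ y → a ≡ b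
+-cancelʳ-≡′ {a} {b} {x} h refl = +-cancelʳ-≡ x a b h

Admissible : ℕ → Triple → Set
Admissible n (t , d , e) = length t ≡ n × length d ≡ zeros t × length e ≡ ones t × ones d ≡ ones e

Admissibles : ℕ → Set
Admissibles n = Σ Triple (Admissible n)

IsG⇒evenLength : ∀ {n} w → IsG n w → EvenLength w
IsG⇒evenLength {n} w (zw , ow) = evenLength w n (trans (length≡zeros+ones w) (cong₂ _+_ zw ow))

splitPairs-admissible : ∀ {n} w → IsG n w → Admissible n (splitPairs w)
splitPairs-admissible {n} w w∈G@(zw , ow) =
  sym (proj₁ balance) , length-oneLedClosers w , length-zeroLedIs00 w , proj₂ balance
  where
  even : EvenLength w
  even = IsG⇒evenLength w w∈G
  balance : n ≡ length (zeroLed w) × ones (oneLedClosers w) ≡ ones (zeroLedIs00 w)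
  balance = cross-cancel n (length (zeroLed w)) (ones (oneLedClosers w)) (ones (zeroLedIs00 w))
              (subst (λ z → z + _ ≡ _) zw (zeros-splitPairs even))
              (subst (λ z → z + _ ≡ _) ow (ones-splitPairs even))

assemblePairs-IsG : ∀ {n} τ → Admissible n τ → IsG n (assemblePairs τ)
assemblePairs-IsG τ@(t , d , e) (lt , ld , le , d≈e) =
    trans (+-cancelʳ-≡′ (subst (λ { (t′ , d′ , e′) → zeros w + ones d′ ≡ length t′ + ones e′ })
                               split≡ (zeros-splitPairs even)) d≈e) lt
  , trans (+-cancelʳ-≡′ (subst (λ { (t′ , d′ , e′) → ones w + ones e′ ≡ length t′ + ones d′ })
                               split≡ (ones-splitPairs even)) (sym d≈e)) lt
  where
  w : List Bool
  w = assemblePairs τ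
  even : EvenLength w
  even = evenLength-assemblePairs τ
  split≡ : splitPairs w ≡ τ
  split≡ = splitPairs-assemblePairs ld le

encodeTriple : List Bool → Triple
encodeTriple u = oneMarks u , zeroMarks (zeroMarks u) , oneMarks (zeroMarks u)

decodeTriple : Triple → List Bool
decodeTriple (t , d , e) = decode (decode d e) t

decodeTriple-encodeTriple : ∀ u → decodeTriple (encodeTriple u) ≡ u
decodeTriple-encodeTriple u =
  trans (cong (λ s → decode s (oneMarks u)) (decode-zeroMarks-oneMarks (zeroMarks u)))
        (decode-zeroMarks-oneMarks u)

module _ {n} (t d e : List Bool) (a : Admissible n (t , d , e)) where

  private
    d≈e : ones d ≡ ones e
    d≈e = proj₂ (proj₂ (proj₂ a))
    s≈t : ones (decode d e) ≡ ones t
    s≈t = trans (ones-decode d e d≈e) (proj₁ (proj₂ (proj₂ a)))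

  encodeTriple-decodeTriple : encodeTriple (decodeTriple (t , d , e)) ≡ (t , d , e)
  encodeTriple-decodeTriple
    rewrite zeroMarks-decode (decode d e) t s≈t
          | oneMarks-decode (decode d e) t s≈t
          | zeroMarks-decode d e d≈e
          | oneMarks-decode d e d≈e = refl

  count001-decodeTriple : count001 (decodeTriple (t , d , e)) ≡ ones e
  count001-decodeTriple = trans (count001-decode (decode d e) t s≈t) (trans (count01-decode d e d≈e) d≈e)

  count01-decodeTriple : count01 (decodeTriple (t , d , e)) ≡ ones t
  count01-decodeTriple = trans (count01-decode (decode d e) t s≈t) s≈t

decodeTriple-IsG : ∀ {n} τ → Admissible n τ → IsG n (decodeTriple τ)
decodeTriple-IsG {n} (t , d , e) (lt , ld , le , d≈e) = zeros≡n , trans (ones-decode s t s≈t) lt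
  where
  open ≡-Reasoning
  s : List Bool
  s = decode d e
  s≈t : ones s ≡ ones t
  s≈t = trans (ones-decode d e d≈e) le
  zeros≡n : zeros (decode s t) ≡ n
  zeros≡n = begin
    zeros (decode s t)  ≡⟨ zeros-decode s t s≈t ⟩
    length s            ≡⟨ length≡zeros+ones s ⟩
    zeros s + ones s    ≡⟨ cong₂ _+_ (zeros-decode d e d≈e) (ones-decode d e d≈e) ⟩
    length d + length e ≡⟨ cong₂ _+_ ld le ⟩
    zeros t + ones t    ≡⟨ length≡zeros+ones t ⟨
    length t            ≡⟨ lt ⟩
    n                   ∎

encodeTriple-admissible : ∀ {n} u → IsG n u → Admissible n (encodeTriple u)
encodeTriple-admissible {n} u (zu , ou) =
    trans (length-oneMarks u) ou
  , trans (length-zeroMarks s) (+-cancelʳ-≡′ zeros+ones≡ s≈t)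
  , trans (length-oneMarks s) s≈t
  , trans (ones-zeroMarks s) (sym (ones-oneMarks s))
  where
  open ≡-Reasoning
  s t : List Bool
  s = zeroMarks u
  t = oneMarks u
  s≈t : ones s ≡ ones t
  s≈t = trans (ones-zeroMarks u) (sym (ones-oneMarks u))
  zeros+ones≡ : zeros s + ones s ≡ zeros t + ones t
  zeros+ones≡ = begin
    zeros s + ones s ≡⟨ length≡zeros+ones s ⟨
    length s         ≡⟨ trans (length-zeroMarks u) zu ⟩
    n                ≡⟨ trans (length-oneMarks u) ou ⟨
    length t         ≡⟨ length≡zeros+ones t ⟩
    zeros t + ones t ∎

Σ-≡-irrelevant : ∀ {A : Set} {P : A → Set} → (∀ x → Irrelevant (P x)) →
                 {p q : Σ A P} → proj₁ p ≡ proj₁ q → p ≡ q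
Σ-≡-irrelevant irr {_ , a} {_ , b} refl = Σ-≡,≡→≡ (refl , irr _ a b)

×-irrelevant : ∀ {A B : Set} → Irrelevant A → Irrelevant B → Irrelevant (A × B)
×-irrelevant irrA irrB (a , b) (a′ , b′) = cong₂ _,_ (irrA a a′) (irrB b b′)

IsG-irrelevant : ∀ {n} w → Irrelevant (IsG n w)
IsG-irrelevant _ = ×-irrelevant ≡-irrelevant ≡-irrelevant

Admissible-irrelevant : ∀ {n} τ → Irrelevant (Admissible n τ)
Admissible-irrelevant _ =
  ×-irrelevant ≡-irrelevant (×-irrelevant ≡-irrelevant (×-irrelevant ≡-irrelevant ≡-irrelevant))

G↔Admissibles-byPairs : ∀ n → G n ↔ Admissibles n
G↔Admissibles-byPairs n = mk↔ₛ′ split assemble split∘assemble assemble∘split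
  where
  split : G n → Admissibles n
  split (w , w∈G) = splitPairs w , splitPairs-admissible w w∈G
  assemble : Admissibles n → G n
  assemble (τ , a) = assemblePairs τ , assemblePairs-IsG τ a
  split∘assemble : ∀ τ → split (assemble τ) ≡ τ
  split∘assemble ((t , d , e) , (_ , ld , le , _)) =
    Σ-≡-irrelevant Admissible-irrelevant (splitPairs-assemblePairs ld le)
  assemble∘split : ∀ w → assemble (split w) ≡ w
  assemble∘split (w , w∈G) = Σ-≡-irrelevant IsG-irrelevant (assemblePairs-splitPairs (IsG⇒evenLength w w∈G))

G↔Admissibles-byMarks : ∀ n → G n ↔ Admissibles n
G↔Admissibles-byMarks n = mk↔ₛ′ encode decode′ encode∘decode decode∘encode
  where
  encode : G n → Admissibles n
  encode (u , u∈G) = encodeTriple u , encodeTriple-admissible u u∈G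
  decode′ : Admissibles n → G n
  decode′ (τ , a) = decodeTriple τ , decodeTriple-IsG τ a
  encode∘decode : ∀ τ → encode (decode′ τ) ≡ τ
  encode∘decode ((t , d , e) , a) = Σ-≡-irrelevant Admissible-irrelevant (encodeTriple-decodeTriple t d e a)
  decode∘encode : ∀ u → decode′ (encode u) ≡ u
  decode∘encode (u , _) = Σ-≡-irrelevant IsG-irrelevant (decodeTriple-encodeTriple u)

φ : List Bool → List Bool
φ w = decodeTriple (splitPairs w)

o00≡count001-φ : ∀ {n} w → IsG n w → o00 w ≡ count001 (φ w)
o00≡count001-φ w w∈G =
  trans (o00≡ones-zeroLedIs00 w)
        (sym (count001-decodeTriple (zeroLed w) (oneLedClosers w) (zeroLedIs00 w) (splitPairs-admissible w w∈G)))

o0≡count01-φ : ∀ {n} w → IsG n w → o0 w ≡ count01 (φ w)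
o0≡count01-φ w w∈G =
  trans (o0≡ones-zeroLed (IsG⇒evenLength w w∈G))
        (sym (count01-decodeTriple (zeroLed w) (oneLedClosers w) (zeroLedIs00 w) (splitPairs-admissible w w∈G)))

theorem3p4 : (n : ℕ) → Σ (G n ⤖ G n) (λ φ → (w : G n) →
               (o00 (proj₁ w) ≡ count001 (proj₁ (Bijection.to φ w)))
               × (o0 (proj₁ w) ≡ count01 (proj₁ (Bijection.to φ w))))
theorem3p4 n =
    ↔⇒⤖ (↔-trans (G↔Admissibles-byPairs n) (↔-sym (G↔Admissibles-byMarks n)))
  , λ (w , w∈G) → o00≡count001-φ w w∈G , o0≡count01-φ w w∈G
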